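{- Let $\mathfrak{h}=\bigoplus_{i\in I}\mathfrak{h}^i$ be a connected Hoffman graph with $\mathfrak{h}^i\in\mathcal{O}$ for every $i\in I$. If $\mathfrak{h}$ is not isomorphic to $\mathfrak{h}_2$, then $\mathrm{Aut}^*(\mathfrak{h})=\{\mathrm{id}_{V(\mathfrak{h})}\}$.
   Context: A Hoffman graph $\mathfrak{h}=(H,\mu)$ is a finite simple graph $H$ with labeling $\mu:V(H)\to\{f,s\}$ such that every fat vertex (label $f$) has a slim neighbour (label $s$), and fat vertices are pairwise non-adjacent; it is connected if $H$ is. $V_s,V_f$ denote slim/fat vertex sets, $N^f_{\mathfrak{h}}(x)$ fat neighbours of $x$. A Hoffman subgraph is an induced subgraph with restricted labeling; isomorphisms/automorphisms are label-preserving graph isomorphisms/automorphisms; membership in families is up to isomorphism. $\mathrm{Aut}^*(\mathfrak{h})=\{\psi\in\mathrm{Aut}(\mathfrak{h}):\psi|_{V_s(\mathfrak{h})}=\mathrm{id}_{V_s(\mathfrak{h})}\}$. Sum: $\mathfrak{h}=\bigoplus_i\mathfrak{h}^i$ (Hoffman subgraphs) means (i) $V(\mathfrak{h})=\bigcup V(\mathfrak{h}^i)$; (ii) $V_s(\mathfrak{h})$ is the disjoint union of the $V_s(\mathfrak{h}^i)$; (iii) $N^f_{\mathfrak{h}^i}(x)=N^f_{\mathfrak{h}}(x)$ for $x\in V_s(\mathfrak{h}^i)$; (iv) for slim $x\in\mathfrak{h}^i$, $y\in\mathfrak{h}^j$, $i\ne j$: $|N^f_{\mathfrak{h}}(x)\cap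 N^f_{\mathfrak{h}}(y)|\le1$ with equality iff $x,y$ adjacent. Indecomposable: not a sum of two non-empty Hoffman subgraphs. Fat: every slim vertex has a fat neighbour. $\mathfrak{h}_2$: one slim vertex adjacent to two fat vertices. $\mathcal{O}$: $\mathfrak{h}_2$ together with all indecomposable fat Hoffman graphs with at least two slim vertices and exactly one fat vertex. -}

module Defs where

open import Data.Bool using (Bool; true; false; T)
open import Data.Fin using (Fin; zero; suc)
open import Data.Nat using (ℕ)
open import Data.Product using (Σ; ∃; ∃-syntax; _×_; _,_; proj₁)
open import Data.Sum using (_⊎_)
open import Relation.Nullary using (¬_)
open import Relation.Binary.PropositionalEquality using (_≡_; _≢_)
open import Function.Bundles using (_↔_; Inverse)

data Label : Set where
  fat slim : Label

record LGraph (V : Set) : Set where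
  field
    adj   : V → V → Bool
    label : V → Label
open LGraph public

module _ {V : Set} (G : LGraph V) where

  Adj : V → V → Set
  Adj x y = T (adj G x y)

  Fat Slim : V → Set
  Fat  x = label G x ≡ fat
  Slim x = label G x ≡ slim

  record IsHoffman : Set where
    field
      irrefl   : ∀ x → ¬ Adj x x
      sym      : ∀ x y → Adj x y → Adj y x
      fatIndep : ∀ x y → Fat x → Fat y → ¬ Adj x y
      fatHasSlimNbr : ∀ x → Fat x → ∃[ y ] (Slim y × Adj x y)

  FatNbr : V → V → Set
  FatNbr s f = Fat f × Adj s f

  IsFat : Set
  IsFat = ∀ x → Slim x → ∃[ f ] FatNbr x f

  AtLeastTwoSlim : Set
  AtLeastTwoSlim = ∃[ x ] ∃[ y ] (Slim x × Slim y × x ≢ y)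

  ExactlyOneFat : Set
  ExactlyOneFat = ∃[ f ] (Fat f × (∀ g → Fat g → g ≡ f))

  data Reach : V → V → Set where
    here : ∀ {x} → Reach x x
    step : ∀ {x y z} → Adj x y → Reach y z → Reach x z

  Connected : Set
  Connected = ∀ x y → Reach x y

module _ {V : Set} (G : LGraph V) where

  Sub : (V → Bool) → Set
  Sub S = Σ V (λ v → T (S v))

  induced : (S : V → Bool) → LGraph (Sub S)
  induced S = record
    { adj   = λ a b → adj G (proj₁ a) (proj₁ b)
    ; label = λ a → label G (proj₁ a) }

  IsHoffmanSubgraph : (V → Bool) → Set
  IsHoffmanSubgraph S = IsHoffman (induced S)

  -- N^f_{h^i}(x) ⊆ N^f_h(x) always holds for induced subgraphs, so (iii)
  -- is the reverse inclusion.  In (iv), "|N^f(x) ∩ N^f(y)| ≤ 1" is written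
  -- out as "any two common fat neighbours coincide", and, given this,
  -- "= 1" is "there is a common fat neighbour".
  record IsSum {I : Set} (S : I → V → Bool) : Set where
    field
      subgraphs : ∀ i → IsHoffmanSubgraph (S i)
      cover     : ∀ v → ∃[ i ] T (S i v)
      slimDisj  : ∀ v i j → Slim G v → T (S i v) → T (S j v) → i ≡ j
      fatNbrs   : ∀ i x f → T (S i x) → Slim G x → FatNbr G x f → T (S i f)
      interact₁ : ∀ i j x y → i ≢ j → T (S i x) → T (S j y) → Slim G x → Slim G y →
                  ∀ f g → FatNbr G x f → FatNbr G y f → FatNbr G x g → FatNbr G y g →
                  f ≡ g
      interact₂ : ∀ i j x y → i ≢ j → T (S i x) → T (S j y) → Slim G x → Slim G y →
                  (Adj G x y → ∃[ f ] (FatNbr G x f × FatNbr G y f)) ×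
                  (∃[ f ] (FatNbr G x f × FatNbr G y f) → Adj G x y)

  two : {A : Set} → A → A → Bool → A
  two a b true  = a
  two a b false = b

  Indecomposable : Set
  Indecomposable = ¬ (Σ (V → Bool) λ A → Σ (V → Bool) λ B →
                      (∃[ v ] T (A v)) × (∃[ v ] T (B v)) × IsSum (two A B))

record Iso {V W : Set} (G : LGraph V) (H : LGraph W) : Set where
  field
    bij      : V ↔ W
    presAdj  : ∀ x y → adj G x y ≡ adj H (Inverse.to bij x) (Inverse.to bij y)
    presLab  : ∀ x → label G x ≡ label H (Inverse.to bij x)

h₂ : LGraph (Fin 3)
h₂ = record { adj = a ; label = l }
  where
  a : Fin 3 → Fin 3 → Bool
  a zero (suc _) = true
  a (suc _) zero = true
  a _ _ = false
  l : Fin 3 → Label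
  l zero = slim
  l (suc _) = fat

InO : {V : Set} → LGraph V → Set
InO G = Iso G h₂ ⊎
        (Indecomposable G × IsFat G × AtLeastTwoSlim G × ExactlyOneFat G)

record AutStar {V : Set} (G : LGraph V) : Set where
  field
    perm    : V ↔ V
    presAdj : ∀ x y → adj G x y ≡ adj G (Inverse.to perm x) (Inverse.to perm y)
    presLab : ∀ x → label G x ≡ label G (Inverse.to perm x)
    fixSlim : ∀ x → Slim G x → Inverse.to perm x ≡ x

module Submission where

-- Let ψ ∈ Aut*(𝔥).  Slim vertices are fixed by definition, so suppose a fat
-- vertex f is moved.  Choose a slim neighbour x of f, lying in the part 𝔥ⁱ.
-- Since ψ fixes x, both f and ψ f are fat neighbours of x, hence lie in 𝔥ⁱ;
-- so 𝔥ⁱ has two fat vertices and, being in 𝒪, must be isomorphic to 𝔥₂.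
-- Then 𝔥ⁱ has exactly the vertices x, f, ψ f.  Any slim vertex w adjacent to
-- f is adjacent to ψ f as well, so if w were in another part, x and w would
-- have two common fat neighbours, contradicting axiom (iv) of a sum.  From
-- this one sees that the vertex set of 𝔥ⁱ is closed under adjacency, hence by
-- connectivity 𝔥ⁱ is all of 𝔥, i.e. 𝔥 ≅ 𝔥₂ — a contradiction.

open import Defs
open import Data.Nat using (ℕ)
open import Data.Fin using (Fin; zero; suc)
open import Data.Fin.Properties using (_≟_)
open import Data.Bool using (Bool; T)
open import Data.Bool.Properties using (T-irrelevant; T?)
open import Data.Empty using (⊥; ⊥-elim)
open import Data.Product using (∃; _,_; proj₁; proj₂)
open import Data.Sum using (_⊎_; inj₁; inj₂)
open import Relation.Nullary using (¬_; yes; no)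
open import Relation.Binary.PropositionalEquality
open import Function.Bundles using (Inverse; mk↔ₛ′)

slim≢fat : ∀ {l : Label} → l ≡ slim → l ≡ fat → ⊥
slim≢fat refl ()

module _ {V : Set} (G : LGraph V) (P : V → Bool)
         (closed : ∀ u w → T (P u) → Adj G u w → T (P w)) where

  reach-closed : ∀ {a v} → Reach G a v → T (P a) → T (P v)
  reach-closed here        pa = pa
  reach-closed (step e r) pa = reach-closed r (closed _ _ pa e)

  connected-closed : Connected G → ∀ a → T (P a) → ∀ v → T (P v)
  connected-closed conn a pa v = reach-closed (conn a v) pa

iso-injective : ∀ {V W} {G : LGraph V} {H : LGraph W} (φ : Iso G H) →
                ∀ a b → Inverse.to (Iso.bij φ) a ≡ Inverse.to (Iso.bij φ) b → a ≡ b
iso-injective φ a b e =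
  trans (sym (Inverse.strictlyInverseʳ (Iso.bij φ) a))
        (trans (cong (Inverse.from (Iso.bij φ)) e) (Inverse.strictlyInverseʳ (Iso.bij φ) b))

iso-induced-total : ∀ {V W} {G : LGraph V} {H : LGraph W} (S : V → Bool) →
                    Iso (induced G S) H → (∀ v → T (S v)) → Iso G H
iso-induced-total S φ total = record
  { bij     = mk↔ₛ′ (λ v → to (v , total v)) (λ y → proj₁ (from y))
                (λ y → trans (cong (λ p → to (proj₁ (from y) , p)) (T-irrelevant _ _))
                             (Inverse.strictlyInverseˡ (Iso.bij φ) y))
                (λ v → cong proj₁ (Inverse.strictlyInverseʳ (Iso.bij φ) (v , total v)))
  ; presAdj = λ a b → Iso.presAdj φ (a , total a) (b , total b)
  ; presLab = λ a → Iso.presLab φ (a , total a) }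
  where
  to   = Inverse.to (Iso.bij φ)
  from = Inverse.from (Iso.bij φ)

two-fat-¬exactly-one : ∀ {V} (H : LGraph V) {a b : V} →
                       Fat H a → Fat H b → a ≢ b → ¬ ExactlyOneFat H
two-fat-¬exactly-one H fa fb a≢b (g , _ , unique) = a≢b (trans (unique _ fa) (sym (unique _ fb)))

module Isomorphic-to-h₂ {V : Set} {H : LGraph V} (φ : Iso H h₂) where

  private
    to : V → Fin 3
    to = Inverse.to (Iso.bij φ)

    slim-index : ∀ a → Slim H a → to a ≡ zero
    slim-index a sa with to a in e
    ... | zero  = refl
    ... | suc _ = ⊥-elim (slim≢fat sa (trans (Iso.presLab φ a) (cong (label h₂) e)))

    fat-index : ∀ a → Fat H a → ∃ λ k → to a ≡ suc k
    fat-index a fa with to a in e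
    ... | zero  = ⊥-elim (slim≢fat (trans (Iso.presLab φ a) (cong (label h₂) e)) fa)
    ... | suc k = k , refl

    fin2-pigeonhole : (k₁ k₂ k₃ : Fin 2) → k₁ ≢ k₂ → k₃ ≡ k₁ ⊎ k₃ ≡ k₂
    fin2-pigeonhole zero       zero       _          k₁≢k₂ = ⊥-elim (k₁≢k₂ refl)
    fin2-pigeonhole (suc zero) (suc zero) _          k₁≢k₂ = ⊥-elim (k₁≢k₂ refl)
    fin2-pigeonhole zero       (suc zero) zero       _     = inj₁ refl
    fin2-pigeonhole zero       (suc zero) (suc zero) _     = inj₂ refl
    fin2-pigeonhole (suc zero) zero       zero       _     = inj₂ refl
    fin2-pigeonhole (suc zero) zero       (suc zero) _     = inj₁ refl

  slim-unique : ∀ a b → Slim H a → Slim H b → a ≡ b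
  slim-unique a b sa sb = iso-injective φ a b (trans (slim-index a sa) (sym (slim-index b sb)))

  fat-pair : ∀ a b c → Fat H a → Fat H b → Fat H c → a ≢ b → c ≡ a ⊎ c ≡ b
  fat-pair a b c fa fb fc a≢b
    with fat-index a fa | fat-index b fb | fat-index c fc
  ... | k₁ , ea | k₂ , eb | k₃ , ec =
    Data.Sum.map (same ec ea) (same ec eb)
      (fin2-pigeonhole k₁ k₂ k₃ (λ k₁≡k₂ → a≢b (same ea eb k₁≡k₂)))
    where
    same : ∀ {u v k l} → to u ≡ suc k → to v ≡ suc l → k ≡ l → u ≡ v
    same eu ev refl = iso-injective φ _ _ (trans eu (sym ev))

module Aut*-facts {V : Set} {G : LGraph V} (ψ : AutStar G) where

  ψ· : V → V
  ψ· = Inverse.to (AutStar.perm ψ)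

  fat-moves-to-fat : ∀ f → Fat G f → Fat G (ψ· f)
  fat-moves-to-fat f ff = trans (sym (AutStar.presLab ψ f)) ff

  private
    slim-adj-invariant : ∀ s f → Slim G s → adj G s f ≡ adj G s (ψ· f)
    slim-adj-invariant s f ss =
      trans (AutStar.presAdj ψ s f) (cong (λ z → adj G z (ψ· f)) (AutStar.fixSlim ψ s ss))

  adj-to-image : ∀ s f → Slim G s → Adj G s f → Adj G s (ψ· f)
  adj-to-image s f ss = subst T (slim-adj-invariant s f ss)

  adj-from-image : ∀ s f → Slim G s → Adj G s (ψ· f) → Adj G s f
  adj-from-image s f ss = subst T (sym (slim-adj-invariant s f ss))

-- In a sum, let g be a fat vertex moved by ψ ∈ Aut*, and x a slim neighbour
-- of g in the part S i.  Then every slim neighbour of g also lies in S i: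
-- otherwise it and x would share the two fat neighbours g and ψ g.
module _ {V : Set} {G : LGraph V} {I : Set} {S : I → V → Bool} (sum : IsSum G S)
         (ψ : AutStar G) where

  open Aut*-facts ψ

  slim-nbrs-of-moved-fat : ∀ {i x w g} → Fat G g → g ≢ ψ· g →
                           Slim G x → T (S i x) → Adj G x g →
                           Slim G w → Adj G w g → T (S i w)
  slim-nbrs-of-moved-fat {i} {x} {w} {g} fg moved sx xi xg sw wg with T? (S i w)
  ... | yes wi = wi
  ... | no  wi̸ = ⊥-elim (moved (IsSum.interact₁ sum i j x w i≢j xi wj sx sw g (ψ· g)
                        (fg , xg) (fg , wg) (fg' , adj-to-image x g sx xg) (fg' , adj-to-image w g sw wg)))
    where
    j   = proj₁ (IsSum.cover sum w)
    wj  = proj₂ (IsSum.cover sum w)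
    fg' = fat-moves-to-fat g fg
    i≢j : i ≢ j
    i≢j refl = wi̸ wj

module Moved-fat-vertex {n : ℕ} {G : LGraph (Fin n)} (hoffman : IsHoffman G)
         (conn : Connected G) {I : Set} {S : I → Fin n → Bool} (sum : IsSum G S)
         (notH₂ : ¬ Iso G h₂) (ψ : AutStar G)
         (f : Fin n) (ff : Fat G f) (moved : f ≢ Inverse.to (AutStar.perm ψ) f) where

  open Aut*-facts ψ
  open IsSum sum using (cover; fatNbrs; interact₂)

  x  = proj₁ (IsHoffman.fatHasSlimNbr hoffman f ff)
  sx = proj₁ (proj₂ (IsHoffman.fatHasSlimNbr hoffman f ff))
  xf : Adj G x f
  xf = IsHoffman.sym hoffman f x (proj₂ (proj₂ (IsHoffman.fatHasSlimNbr hoffman f ff)))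
  i  = proj₁ (cover x)
  xi = proj₂ (cover x)
  fψ : Fat G (ψ· f)
  fψ = fat-moves-to-fat f ff
  fi : T (S i f)
  fi = fatNbrs i x f xi sx (ff , xf)
  ψfi : T (S i (ψ· f))
  ψfi = fatNbrs i x (ψ· f) xi sx (fψ , adj-to-image x f sx xf)

  slim-nbr-in-part : ∀ w → Slim G w → Adj G w f ⊎ Adj G w (ψ· f) → T (S i w)
  slim-nbr-in-part w sw adj-w =
    slim-nbrs-of-moved-fat sum ψ ff moved sx xi xf sw
      (Data.Sum.[ (λ wf → wf) , adj-from-image w f sw ] adj-w)

  module _ (φ : Iso (induced G (S i)) h₂) where
    open Isomorphic-to-h₂ φ

    fat-in-part : ∀ u → T (S i u) → Fat G u → u ≡ f ⊎ u ≡ ψ· f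
    fat-in-part u ui fu =
      Data.Sum.map (cong proj₁) (cong proj₁)
        (fat-pair (f , fi) (ψ· f , ψfi) (u , ui) ff fψ fu (λ e → moved (cong proj₁ e)))

    nbr-of-fat-in-part : ∀ u w → T (S i u) → Fat G u → Adj G u w → T (S i w)
    nbr-of-fat-in-part u w ui fu uw with label G w in lw
    ... | fat  = ⊥-elim (IsHoffman.fatIndep hoffman u w fu lw uw)
    ... | slim with fat-in-part u ui fu
    ... | inj₁ refl = slim-nbr-in-part w lw (inj₁ (IsHoffman.sym hoffman u w uw))
    ... | inj₂ refl = slim-nbr-in-part w lw (inj₂ (IsHoffman.sym hoffman u w uw))

    -- x and a slim neighbour w in another part share a fat vertex g ∈ 𝔥ⁱ
    nbr-of-x : ∀ w → Adj G x w → T (S i w)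
    nbr-of-x w xw with label G w in lw
    ... | fat  = fatNbrs i x w xi sx (lw , xw)
    ... | slim with T? (S i w)
    ...   | yes wi = wi
    ...   | no  wi̸ = ⊥-elim (wi̸ (nbr-of-fat-in-part g w gi (proj₁ xg) (IsHoffman.sym hoffman w g (proj₂ wg))))
      where
      j  = proj₁ (cover w)
      i≢j : i ≢ j
      i≢j i≡j = wi̸ (subst (λ k → T (S k w)) (sym i≡j) (proj₂ (cover w)))
      common = proj₁ (interact₂ i j x w i≢j xi (proj₂ (cover w)) sx lw) xw
      g  = proj₁ common
      xg = proj₁ (proj₂ common)
      wg = proj₂ (proj₂ common)
      gi = fatNbrs i x g xi sx xg

    part-closed : ∀ u w → T (S i u) → Adj G u w → T (S i w)
    part-closed u w ui uw with label G u in lu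
    ... | fat  = nbr-of-fat-in-part u w ui lu uw
    ... | slim with slim-unique (u , ui) (x , xi) lu sx
    ... | refl = nbr-of-x w uw

  contradiction : InO (induced G (S i)) → ⊥
  contradiction (inj₁ φ) =
    notH₂ (iso-induced-total (S i) φ (connected-closed G (S i) (part-closed φ) conn x xi))
  contradiction (inj₂ (_ , _ , _ , one-fat)) =
    two-fat-¬exactly-one (induced G (S i)) {f , fi} {ψ· f , ψfi} ff fψ
      (λ e → moved (cong proj₁ e)) one-fat

proposition5p3 : (n : ℕ) (G : LGraph (Fin n)) → IsHoffman G → Connected G →
                 (I : Set) (S : I → Fin n → Bool) → IsSum G S →
                 (∀ i → InO (induced G (S i))) →
                 ¬ Iso G h₂ →
                 (ψ : AutStar G) → ∀ v → Inverse.to (AutStar.perm ψ) v ≡ v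
proposition5p3 n G hoffman conn I S sum parts-in-O notH₂ ψ v with label G v in lv
... | slim = AutStar.fixSlim ψ v lv
... | fat with v ≟ Inverse.to (AutStar.perm ψ) v
...   | yes fixed = sym fixed
...   | no  moved = ⊥-elim (contradiction (parts-in-O i))
  where open Moved-fat-vertex hoffman conn sum notH₂ ψ v lv moved
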